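{- Let $0<\varepsilon<1$ and let $I$ be an instance of coloured bin packing. For each colour $c$, let the large items of colour $c$ (those of size at least $\varepsilon^2$), $n_c$ in number, be sorted in decreasing order of size, and let $Q_c$ be the first $\lfloor n_c\varepsilon^3\rfloor$ of them; let $Q=\bigcup_c Q_c$. Pack $Q$ into new bins using First Fit, processing all items of one colour before the next colour. If $P(Q)$ denotes the number of bins used and $P(Q_c)$ the number of these bins containing an item of colour $c$, then $P(Q)\le\varepsilon\,\mathrm{OPT}(I)$ and $P(Q_c)\le\varepsilon\,\mathrm{OPT}(I_c)$ for each colour $c$.
   Context: Coloured bin packing: an instance $I$ is a finite set of items, each item $e$ having a size $s(e)\in(0,1]$ and a colour $c(e)\in\{1,\dots,m\}$; items are packed into unit-capacity bins. $I_c$ is the set of items of colour $c$; $\mathrm{OPT}(I)$, $\mathrm{OPT}(I_c)$ are the minimum numbers of bins needed to pack $I$, $I_c$. First Fit places each item into the first bin (in order of opening) with room for it, opening a new bin if none has room.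
   Formalization: The parameter ε and the item sizes $s(e)$ are rational. -}

module Defs where

open import Data.Nat using (ℕ; zero; suc)
open import Data.Integer using (ℤ; +_; ∣_∣)
open import Data.Fin using (Fin)
import Data.Fin as Fin
open import Data.Rational using (ℚ; 0ℚ; 1ℚ; _+_; _*_; _≤_; _<_; _/_; floor)
open import Data.Rational.Properties using (_≤?_)
open import Data.List using (List; []; _∷_; length; filter; take; concat; concatMap; foldr; map)
open import Data.List.Relation.Unary.All using (All)
open import Data.List.Relation.Unary.Any using (Any)
open import Data.List.Relation.Binary.Permutation.Propositional using (_↭_)
open import Data.List.Relation.Unary.Linked using (Linked)
open import Data.List.Relation.Unary.Any using (any?)
open import Data.Product using (Σ; ∃; _×_; _,_)
open import Relation.Binary.PropositionalEquality using (_≡_)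
open import Relation.Nullary using (yes; no)

record Item (m : ℕ) : Set where
  constructor item
  field
    size   : ℚ
    colour : Fin m
open Item public

ℕ→ℚ : ℕ → ℚ
ℕ→ℚ n = + n / 1

ValidInstance : ∀ {m} → List (Item m) → Set
ValidInstance I = All (λ e → (0ℚ < size e) × (size e ≤ 1ℚ)) I

load : ∀ {m} → List (Item m) → ℚ
load = foldr (λ e acc → size e + acc) 0ℚ

colourClass : ∀ {m} → Fin m → List (Item m) → List (Item m)
colourClass c = filter (λ e → colour e Fin.≟ c)

Packable : ∀ {m} → List (Item m) → ℕ → Set
Packable {m} L k = Σ (List (List (Item m))) λ bins →
  (length bins ≡ k) × (concat bins ↭ L) × All (λ b → load b ≤ 1ℚ) bins

IsOPT : ∀ {m} → List (Item m) → ℕ → Set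
IsOPT L k = Packable L k × (∀ j → Packable L j → k Data.Nat.≤ j)

ffInsert : ∀ {m} → Item m → List (List (Item m)) → List (List (Item m))
ffInsert e [] = (e ∷ []) ∷ []
ffInsert e (b ∷ bs) with (size e + load b) ≤? 1ℚ
... | yes _ = (b ∷ₗ e) ∷ bs
  where
    _∷ₗ_ : List _ → _ → List _
    xs ∷ₗ x = xs Data.List.++ (x ∷ [])
... | no _  = b ∷ ffInsert e bs

firstFitAux : ∀ {m} → List (List (Item m)) → List (Item m) → List (List (Item m))
firstFitAux bins [] = bins
firstFitAux bins (e ∷ es) = firstFitAux (ffInsert e bins) es

firstFit : ∀ {m} → List (Item m) → List (List (Item m))
firstFit = firstFitAux []

largeOfColour : ∀ {m} → ℚ → Fin m → List (Item m) → List (Item m)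
largeOfColour ε c I = filter (λ e → (ε * ε) ≤? size e) (colourClass c I)

SortedDecreasing : ∀ {m} → List (Item m) → Set
SortedDecreasing = Linked (λ x y → size y ≤ size x)

-- ⌊ n ε³ ⌋ (as a natural number; the argument is non-negative for ε > 0)
floorMul : ℕ → ℚ → ℕ
floorMul n ε = ∣ floor (ℕ→ℚ n * (ε * ε * ε)) ∣

Qc : ∀ {m} → ℚ → List (Item m) → List (Item m)
Qc ε Sc = take (floorMul (length Sc) ε) Sc

Qseq : ∀ {m} → ℚ → (Fin m → List (Item m)) → List (Item m)
Qseq {m} ε S = concatMap (λ c → Qc ε (S c)) (Data.List.allFin m)

binsWithColour : ∀ {m} → Fin m → List (List (Item m)) → ℕ
binsWithColour c bins = length (filter (any? (λ e → colour e Fin.≟ c)) bins)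

module Submission where

-- Write n_c for the number of
-- large items (size ≥ ε²) of colour c, and N for the number of large items
-- of I.
--   * Volume:  N·ε² ≤ load(I) ≤ OPT(I), since the large items alone weigh at
--     least N·ε² and every bin of an optimal packing has load ≤ 1; likewise
--     n_c·ε² ≤ OPT(I_c).
--   * First Fit never opens more bins than it receives items, and it only
--     rearranges items, so a bin meeting colour c accounts for at least one
--     item of colour c.
--   * |Q_c| = ⌊n_c ε³⌋ ≤ n_c ε³, the items of Q of colour c are exactly Q_c,
--     and summing over colours gives |Q| ≤ (Σ_c n_c)·ε³ = N·ε³.
-- Multiplying the volume bounds by ε finishes both claims.

open import Defs
open import Data.Nat as ℕ using (ℕ; zero; suc; z≤n; s≤s)
import Data.Nat.Properties as ℕ
import Data.Nat.DivMod as ℕ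
open import Data.Nat.ListAction using (sum)
open import Data.Integer as ℤ using (-[1+_]; ∣_∣)
import Data.Integer.Properties as ℤ
import Data.Nat.Coprimality as Coprime
open import Data.Fin as Fin using (Fin)
open import Data.Fin.Properties using (suc-injective)
open import Data.Rational
  using (ℚ; mkℚ; 0ℚ; 1ℚ; _+_; _*_; _≤_; _<_; floor; toℚᵘ; *≤*; NonNegative; nonNegative)
open import Data.Rational.Properties
import Data.Rational.Unnormalised as ℚᵘ
import Data.Rational.Unnormalised.Properties as ℚᵘ
open import Data.List
  using (List; []; _∷_; [_]; length; filter; concat; concatMap; foldr; map; _++_; allFin; tabulate)
open import Data.List.Properties
  using (length-++; length-take; filter-++; filter-accept; filter-reject; filter-all; filter-none;
         filter-some; map-tabulate; map-cong; foldr-map; ++-assoc; ++-identityʳ)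
open import Data.List.Relation.Unary.All as All using (All; []; _∷_)
open import Data.List.Relation.Unary.All.Properties using (all-filter; filter⁺; take⁺)
open import Data.List.Relation.Unary.Any using (any?)
open import Data.List.Relation.Binary.Permutation.Propositional
  using (_↭_; ↭-refl; ↭-trans; ↭-sym; ↭⇒↭ₛ)
open import Data.List.Relation.Binary.Permutation.Propositional.Properties
  using (↭-length; ++⁺ˡ; ++⁺ʳ; shift; filter-↭; map⁺; All-resp-↭)
open import Data.List.Relation.Binary.Permutation.Setoid.Properties using (foldr-commMonoid)
open import Data.Product using (_×_; _,_; proj₁)
open import Data.Empty using (⊥-elim)
open import Relation.Nullary using (yes; no)
open import Level using (0ℓ)
open import Relation.Unary using (Pred; Decidable)
open import Relation.Binary.PropositionalEquality
  using (_≡_; _≢_; refl; sym; trans; cong; cong₂; subst; subst₂; module ≡-Reasoning)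
open import Algebra.Bundles using (CommutativeMonoid)
import Algebra.Properties.CommutativeSemigroup as CommSemigroup

ℕ→ℚ-mkℚ : ∀ n → ℕ→ℚ n ≡ mkℚ (ℤ.+ n) 0 (Coprime.sym (Coprime.1-coprimeTo n))
ℕ→ℚ-mkℚ n = normalize-coprime (Coprime.sym (Coprime.1-coprimeTo n))

ℕ→ℚ-mono : ∀ {m n} → m ℕ.≤ n → ℕ→ℚ m ≤ ℕ→ℚ n
ℕ→ℚ-mono {m} {n} m≤n rewrite ℕ→ℚ-mkℚ m | ℕ→ℚ-mkℚ n =
  *≤* (subst₂ ℤ._≤_ (sym (ℤ.*-identityʳ (ℤ.+ m))) (sym (ℤ.*-identityʳ (ℤ.+ n))) (ℤ.+≤+ m≤n))

ℕ→ℚ-nonNeg : ∀ n → 0ℚ ≤ ℕ→ℚ n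
ℕ→ℚ-nonNeg n = ℕ→ℚ-mono {0} {n} z≤n

ℕ→ℚ-+ : ∀ m n → ℕ→ℚ (m ℕ.+ n) ≡ ℕ→ℚ m + ℕ→ℚ n
ℕ→ℚ-+ m n = toℚᵘ-injective (ℚᵘ.≃-trans sum≃ (ℚᵘ.≃-sym (toℚᵘ-homo-+ (ℕ→ℚ m) (ℕ→ℚ n))))
  where
  sum≃ : toℚᵘ (ℕ→ℚ (m ℕ.+ n)) ℚᵘ.≃ toℚᵘ (ℕ→ℚ m) ℚᵘ.+ toℚᵘ (ℕ→ℚ n)
  sum≃ rewrite ℕ→ℚ-mkℚ (m ℕ.+ n) | ℕ→ℚ-mkℚ m | ℕ→ℚ-mkℚ n =
    ℚᵘ.*≡* (cong (ℤ._* ℤ.+ 1) (trans (ℤ.pos-+ m n)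
      (cong₂ ℤ._+_ (sym (ℤ.*-identityʳ (ℤ.+ m))) (sym (ℤ.*-identityʳ (ℤ.+ n))))))

ℕ→ℚ-suc : ∀ n → ℕ→ℚ (suc n) ≡ 1ℚ + ℕ→ℚ n
ℕ→ℚ-suc = ℕ→ℚ-+ 1

-- The floor of a non-negative rational, read as a natural number, is below it:
-- for q = a/(d+1) this is (a div (d+1))·(d+1) ≤ a.
⌊⌋-≤ : ∀ q → 0ℚ ≤ q → ℕ→ℚ ∣ floor q ∣ ≤ q
⌊⌋-≤ (mkℚ -[1+ a ] d c) 0≤q = ⊥-elim (ℤ.NonNegative.nonNeg (nonNegative 0≤q))
⌊⌋-≤ (mkℚ (ℤ.+ a) d c) _
  rewrite ℕ→ℚ-mkℚ ∣ floor (mkℚ (ℤ.+ a) d c) ∣ | cong ∣_∣ (ℤ.*-identityˡ (ℤ.+ (a ℕ./ suc d))) =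
  *≤* (subst₂ ℤ._≤_ (ℤ.pos-* (a ℕ./ suc d) (suc d)) (sym (ℤ.*-identityʳ (ℤ.+ a)))
        (ℤ.+≤+ (ℕ.m/n*n≤m a (suc d))))

floorMul-≤ : ∀ n ε .{{_ : NonNegative ε}} → ℕ→ℚ (floorMul n ε) ≤ ℕ→ℚ n * (ε * ε * ε)
floorMul-≤ n ε = ⌊⌋-≤ (ℕ→ℚ n * (ε * ε * ε)) (nonNegative⁻¹ _ {{nonNeg*nonNeg⇒nonNeg (ℕ→ℚ n) (ε * ε * ε)}})
  where
  instance
    n-nonNeg : NonNegative (ℕ→ℚ n)
    n-nonNeg = nonNegative (ℕ→ℚ-nonNeg n)
    ε²-nonNeg : NonNegative (ε * ε)
    ε²-nonNeg = nonNeg*nonNeg⇒nonNeg ε ε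
    ε³-nonNeg : NonNegative (ε * ε * ε)
    ε³-nonNeg = nonNeg*nonNeg⇒nonNeg (ε * ε) ε

ℕ→ℚ-sum-≤ : ∀ {B : Set} (g f : B → ℕ) (r : ℚ) (xs : List B) →
  (∀ x → ℕ→ℚ (g x) ≤ ℕ→ℚ (f x) * r) →
  ℕ→ℚ (sum (map g xs)) ≤ ℕ→ℚ (sum (map f xs)) * r
ℕ→ℚ-sum-≤ g f r [] _ = ≤-reflexive (sym (*-zeroˡ r))
ℕ→ℚ-sum-≤ g f r (x ∷ xs) g≤f = begin
  ℕ→ℚ (g x ℕ.+ sum (map g xs))                  ≡⟨ ℕ→ℚ-+ (g x) _ ⟩
  ℕ→ℚ (g x) + ℕ→ℚ (sum (map g xs))              ≤⟨ +-mono-≤ (g≤f x) (ℕ→ℚ-sum-≤ g f r xs g≤f) ⟩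
  ℕ→ℚ (f x) * r + ℕ→ℚ (sum (map f xs)) * r      ≡⟨ sym (*-distribʳ-+ r (ℕ→ℚ (f x)) _) ⟩
  (ℕ→ℚ (f x) + ℕ→ℚ (sum (map f xs))) * r        ≡⟨ cong (_* r) (sym (ℕ→ℚ-+ (f x) _)) ⟩
  ℕ→ℚ (f x ℕ.+ sum (map f xs)) * r              ∎
  where open ≤-Reasoning

scale-by-ε : ∀ x k ε .{{_ : NonNegative ε}} → x * (ε * ε) ≤ k → x * (ε * ε * ε) ≤ ε * k
scale-by-ε x k ε xε²≤k = begin
  x * (ε * ε * ε)  ≡⟨ sym (*-assoc x (ε * ε) ε) ⟩
  x * (ε * ε) * ε  ≡⟨ *-comm (x * (ε * ε)) ε ⟩
  ε * (x * (ε * ε)) ≤⟨ *-monoˡ-≤-nonNeg ε xε²≤k ⟩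
  ε * k            ∎
  where open ≤-Reasoning

module _ {m : ℕ} where

  load-↭ : {xs ys : List (Item m)} → xs ↭ ys → load xs ≡ load ys
  load-↭ {xs} {ys} p = begin
    load xs                    ≡⟨ sym (foldr-map _+_ size 0ℚ xs) ⟩
    foldr _+_ 0ℚ (map size xs) ≡⟨ foldr-commMonoid Q.setoid Q.isCommutativeMonoid (↭⇒↭ₛ (map⁺ size p)) ⟩
    foldr _+_ 0ℚ (map size ys) ≡⟨ foldr-map _+_ size 0ℚ ys ⟩
    load ys                    ∎
    where
    module Q = CommutativeMonoid +-0-commutativeMonoid
    open ≡-Reasoning

  load-++ : (xs ys : List (Item m)) → load (xs ++ ys) ≡ load xs + load ys
  load-++ []       ys = sym (+-identityˡ (load ys))
  load-++ (x ∷ xs) ys = trans (cong (size x +_) (load-++ xs ys)) (sym (+-assoc (size x) (load xs) (load ys)))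

  load-concat-≤ : (bins : List (List (Item m))) → All (λ b → load b ≤ 1ℚ) bins →
    load (concat bins) ≤ ℕ→ℚ (length bins)
  load-concat-≤ []       []       = ≤-refl
  load-concat-≤ (b ∷ bs) (b≤1 ∷ bs≤1) rewrite load-++ b (concat bs) | ℕ→ℚ-suc (length bs) =
    +-mono-≤ b≤1 (load-concat-≤ bs bs≤1)

  load-≤-packable : (L : List (Item m)) (k : ℕ) → Packable L k → load L ≤ ℕ→ℚ k
  load-≤-packable L k (bins , refl , bins↭L , fits) =
    subst (_≤ ℕ→ℚ (length bins)) (load-↭ bins↭L) (load-concat-≤ bins fits)

  load-filter-≤ : {P : Pred (Item m) 0ℓ} (P? : Decidable P) (xs : List (Item m)) →
    All (λ e → 0ℚ ≤ size e) xs → load (filter P? xs) ≤ load xs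
  load-filter-≤ P? []       []         = ≤-refl
  load-filter-≤ P? (x ∷ xs) (0≤x ∷ 0≤xs) with P? x
  ... | yes _ = +-monoʳ-≤ (size x) (load-filter-≤ P? xs 0≤xs)
  ... | no  _ = begin
    load (filter P? xs) ≤⟨ load-filter-≤ P? xs 0≤xs ⟩
    load xs             ≡⟨ sym (+-identityˡ (load xs)) ⟩
    0ℚ + load xs        ≤⟨ +-monoˡ-≤ (load xs) 0≤x ⟩
    size x + load xs    ∎
    where open ≤-Reasoning

  length*δ-≤-load : (δ : ℚ) (xs : List (Item m)) → All (λ e → δ ≤ size e) xs →
    ℕ→ℚ (length xs) * δ ≤ load xs
  length*δ-≤-load δ []       []         = ≤-reflexive (*-zeroˡ δ)
  length*δ-≤-load δ (x ∷ xs) (δ≤x ∷ δ≤xs)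
    rewrite ℕ→ℚ-suc (length xs) | *-distribʳ-+ δ 1ℚ (ℕ→ℚ (length xs)) | *-identityˡ δ =
    +-mono-≤ δ≤x (length*δ-≤-load δ xs δ≤xs)

  large-count-≤-OPT : (δ : ℚ) (L : List (Item m)) (k : ℕ) → All (λ e → 0ℚ ≤ size e) L → IsOPT L k →
    ℕ→ℚ (length (filter (λ e → δ ≤? size e) L)) * δ ≤ ℕ→ℚ k
  large-count-≤-OPT δ L k 0≤L (packing , _) = begin
    ℕ→ℚ (length large) * δ ≤⟨ length*δ-≤-load δ large (all-filter (λ e → δ ≤? size e) L) ⟩
    load large             ≤⟨ load-filter-≤ (λ e → δ ≤? size e) L 0≤L ⟩
    load L                 ≤⟨ load-≤-packable L k packing ⟩
    ℕ→ℚ k                  ∎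
    where
    large = filter (λ e → δ ≤? size e) L
    open ≤-Reasoning

module _ {A : Set} {P : Pred A 0ℓ} (P? : Decidable P) where

  count : List A → ℕ
  count xs = length (filter P? xs)

  count-++ : ∀ xs ys → count (xs ++ ys) ≡ count xs ℕ.+ count ys
  count-++ xs ys = trans (cong length (filter-++ P? xs ys)) (length-++ (filter P? xs))

  count-concatMap : {B : Set} (f : B → List A) (bs : List B) →
    count (concatMap f bs) ≡ sum (map (λ b → count (f b)) bs)
  count-concatMap f []       = refl
  count-concatMap f (b ∷ bs) = trans (count-++ (f b) (concatMap f bs)) (cong (count (f b) ℕ.+_) (count-concatMap f bs))

  lists-meeting-≤-count : (xss : List (List A)) → length (filter (any? P?) xss) ℕ.≤ count (concat xss)
  lists-meeting-≤-count []         = z≤n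
  lists-meeting-≤-count (xs ∷ xss) rewrite count-++ xs (concat xss) with any? P? xs
  ... | yes meets = ℕ.+-mono-≤ (filter-some P? meets) (lists-meeting-≤-count xss)
  ... | no  _     = ℕ.≤-trans (lists-meeting-≤-count xss) (ℕ.m≤n+m _ (count xs))

length-concatMap : {A B : Set} (f : B → List A) (bs : List B) →
  length (concatMap f bs) ≡ sum (map (λ b → length (f b)) bs)
length-concatMap f []       = refl
length-concatMap f (b ∷ bs) = trans (length-++ (f b)) (cong (length (f b) ℕ.+_) (length-concatMap f bs))

sum-map-+ : {B : Set} (f g : B → ℕ) (xs : List B) →
  sum (map (λ x → f x ℕ.+ g x) xs) ≡ sum (map f xs) ℕ.+ sum (map g xs)
sum-map-+ f g []       = refl
sum-map-+ f g (x ∷ xs) rewrite sum-map-+ f g xs =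
  CommSemigroup.interchange ℕ.+-commutativeSemigroup (f x) (g x) (sum (map f xs)) (sum (map g xs))

sum-allFin-single : ∀ n (f : Fin n → ℕ) (c : Fin n) → (∀ d → d ≢ c → f d ≡ 0) →
  sum (map f (allFin n)) ≡ f c
sum-allFin-single n f c vanish = trans (cong sum (map-tabulate (λ d → d) f)) (sum-tabulate n f c vanish)
  where
  sum-tabulate-zero : ∀ n (f : Fin n → ℕ) → (∀ d → f d ≡ 0) → sum (tabulate f) ≡ 0
  sum-tabulate-zero zero    f zero-f = refl
  sum-tabulate-zero (suc n) f zero-f rewrite zero-f Fin.zero = sum-tabulate-zero n (λ d → f (Fin.suc d)) (λ d → zero-f (Fin.suc d))

  sum-tabulate : ∀ n (f : Fin n → ℕ) (c : Fin n) → (∀ d → d ≢ c → f d ≡ 0) → sum (tabulate f) ≡ f c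
  sum-tabulate (suc n) f Fin.zero vanish
    rewrite sum-tabulate-zero n (λ d → f (Fin.suc d)) (λ d → vanish (Fin.suc d) (λ ())) = ℕ.+-identityʳ (f Fin.zero)
  sum-tabulate (suc n) f (Fin.suc c) vanish rewrite vanish Fin.zero (λ ()) =
    sum-tabulate n (λ d → f (Fin.suc d)) c (λ d d≢c → vanish (Fin.suc d) (λ eq → d≢c (suc-injective eq)))

module _ {A : Set} {n : ℕ} (κ : A → Fin n) {P : Pred A 0ℓ} (P? : Decidable P) where

  ofColour : Fin n → List A → List A
  ofColour c = filter (λ x → κ x Fin.≟ c)

  count-partition : (xs : List A) → sum (map (λ c → count P? (ofColour c xs)) (allFin n)) ≡ count P? xs
  count-partition []       = sum-map-0 (allFin n)
    where
    sum-map-0 : {B : Set} (bs : List B) → sum (map (λ _ → 0) bs) ≡ 0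
    sum-map-0 []       = refl
    sum-map-0 (_ ∷ bs) = sum-map-0 bs
  count-partition (x ∷ xs) = begin
    sum (map (λ c → count P? (ofColour c (x ∷ xs))) (allFin n))
      ≡⟨ cong sum (map-cong split (allFin n)) ⟩
    sum (map (λ c → count P? (ofColour c [ x ]) ℕ.+ count P? (ofColour c xs)) (allFin n))
      ≡⟨ sum-map-+ (λ c → count P? (ofColour c [ x ])) (λ c → count P? (ofColour c xs)) (allFin n) ⟩
    sum (map (λ c → count P? (ofColour c [ x ])) (allFin n)) ℕ.+ sum (map (λ c → count P? (ofColour c xs)) (allFin n))
      ≡⟨ cong₂ ℕ._+_ (sum-allFin-single n (λ c → count P? (ofColour c [ x ])) (κ x) vanish) (count-partition xs) ⟩
    count P? (ofColour (κ x) [ x ]) ℕ.+ count P? xs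
      ≡⟨ cong (λ ys → count P? ys ℕ.+ count P? xs) (filter-accept (λ y → κ y Fin.≟ κ x) refl) ⟩
    count P? [ x ] ℕ.+ count P? xs
      ≡⟨ sym (count-++ P? [ x ] xs) ⟩
    count P? (x ∷ xs) ∎
    where
    open ≡-Reasoning
    split : ∀ c → count P? (ofColour c (x ∷ xs)) ≡ count P? (ofColour c [ x ]) ℕ.+ count P? (ofColour c xs)
    split c = trans (cong (count P?) (filter-++ (λ y → κ y Fin.≟ c) [ x ] xs)) (count-++ P? (ofColour c [ x ]) (ofColour c xs))
    vanish : ∀ d → d ≢ κ x → count P? (ofColour d [ x ]) ≡ 0
    vanish d d≢κx = cong (count P?) (filter-reject (λ y → κ y Fin.≟ d) (λ κx≡d → d≢κx (sym κx≡d)))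

module _ {m : ℕ} where

  ffInsert-length : (e : Item m) (bins : List (List (Item m))) → length (ffInsert e bins) ℕ.≤ suc (length bins)
  ffInsert-length e []       = ℕ.≤-refl
  ffInsert-length e (b ∷ bs) with (size e + load b) ≤? 1ℚ
  ... | yes _ = ℕ.n≤1+n _
  ... | no  _ = s≤s (ffInsert-length e bs)

  firstFitAux-length : (bins : List (List (Item m))) (L : List (Item m)) →
    length (firstFitAux bins L) ℕ.≤ length bins ℕ.+ length L
  firstFitAux-length bins []      = ℕ.m≤m+n _ 0
  firstFitAux-length bins (e ∷ L) = begin
    length (firstFitAux (ffInsert e bins) L) ≤⟨ firstFitAux-length (ffInsert e bins) L ⟩
    length (ffInsert e bins) ℕ.+ length L    ≤⟨ ℕ.+-monoˡ-≤ (length L) (ffInsert-length e bins) ⟩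
    suc (length bins) ℕ.+ length L           ≡⟨ sym (ℕ.+-suc (length bins) (length L)) ⟩
    length bins ℕ.+ length (e ∷ L)           ∎
    where open ℕ.≤-Reasoning

  firstFit-length : (L : List (Item m)) → length (firstFit L) ℕ.≤ length L
  firstFit-length = firstFitAux-length []

  ffInsert-contents : (e : Item m) (bins : List (List (Item m))) → concat (ffInsert e bins) ↭ e ∷ concat bins
  ffInsert-contents e []       = ↭-refl
  ffInsert-contents e (b ∷ bs) with (size e + load b) ≤? 1ℚ
  ... | yes _ = subst (_↭ e ∷ b ++ concat bs) (sym (++-assoc b [ e ] (concat bs))) (shift e b (concat bs))
  ... | no  _ = ↭-trans (++⁺ˡ b (ffInsert-contents e bs)) (shift e b (concat bs))

  firstFitAux-contents : (bins : List (List (Item m))) (L : List (Item m)) →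
    concat (firstFitAux bins L) ↭ concat bins ++ L
  firstFitAux-contents bins []      = subst (concat bins ↭_) (sym (++-identityʳ (concat bins))) ↭-refl
  firstFitAux-contents bins (e ∷ L) = ↭-trans (firstFitAux-contents (ffInsert e bins) L)
    (↭-trans (++⁺ʳ L (ffInsert-contents e bins)) (↭-sym (shift e (concat bins) L)))

  firstFit-contents : (L : List (Item m)) → concat (firstFit L) ↭ L
  firstFit-contents = firstFitAux-contents []

  hasColour? : (c : Fin m) → Decidable (λ (e : Item m) → colour e ≡ c)
  hasColour? c e = colour e Fin.≟ c

  binsWithColour-≤ : (c : Fin m) (L : List (Item m)) → binsWithColour c (firstFit L) ℕ.≤ count (hasColour? c) L
  binsWithColour-≤ c L = ℕ.≤-trans (lists-meeting-≤-count (hasColour? c) (firstFit L))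
    (ℕ.≤-reflexive (↭-length (filter-↭ (hasColour? c) (firstFit-contents L))))

module _ {m : ℕ} (ε : ℚ) where

  large? : Decidable (λ (e : Item m) → ε * ε ≤ size e)
  large? e = ε * ε ≤? size e

  large-count-ε³-≤ : .{{_ : NonNegative ε}} (L : List (Item m)) (k : ℕ) →
    All (λ e → 0ℚ ≤ size e) L → IsOPT L k → ℕ→ℚ (count large? L) * (ε * ε * ε) ≤ ε * ℕ→ℚ k
  large-count-ε³-≤ L k 0≤L opt = scale-by-ε (ℕ→ℚ (count large? L)) (ℕ→ℚ k) ε (large-count-≤-OPT (ε * ε) L k 0≤L opt)

  arranged-coloured : (c : Fin m) (I Sc : List (Item m)) → Sc ↭ largeOfColour ε c I → All (λ e → colour e ≡ c) Sc
  arranged-coloured c I Sc Sc↭large = All-resp-↭ (↭-sym Sc↭large) (filter⁺ large? (all-filter (hasColour? c) I))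

  Qc-length-≤ : .{{_ : NonNegative ε}} (Sc : List (Item m)) → ℕ→ℚ (length (Qc ε Sc)) ≤ ℕ→ℚ (length Sc) * (ε * ε * ε)
  Qc-length-≤ Sc = ≤-trans (ℕ→ℚ-mono length≤floor) (floorMul-≤ (length Sc) ε)
    where
    length≤floor : length (Qc ε Sc) ℕ.≤ floorMul (length Sc) ε
    length≤floor = ℕ.≤-trans (ℕ.≤-reflexive (length-take (floorMul (length Sc) ε) Sc)) (ℕ.m⊓n≤m _ _)

  Qseq-length : (S : Fin m → List (Item m)) → length (Qseq ε S) ≡ sum (map (λ c → length (Qc ε (S c))) (allFin m))
  Qseq-length S = length-concatMap (λ c → Qc ε (S c)) (allFin m)

  Qseq-count : (S : Fin m → List (Item m)) → (∀ d → All (λ e → colour e ≡ d) (S d)) →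
    (c : Fin m) → count (hasColour? c) (Qseq ε S) ≡ length (Qc ε (S c))
  Qseq-count S S-coloured c = begin
    count (hasColour? c) (Qseq ε S)
      ≡⟨ count-concatMap (hasColour? c) (λ d → Qc ε (S d)) (allFin m) ⟩
    sum (map (λ d → count (hasColour? c) (Qc ε (S d))) (allFin m))
      ≡⟨ sum-allFin-single m (λ d → count (hasColour? c) (Qc ε (S d))) c vanish ⟩
    count (hasColour? c) (Qc ε (S c))
      ≡⟨ cong length (filter-all (hasColour? c) (Qc-coloured c)) ⟩
    length (Qc ε (S c)) ∎
    where
    open ≡-Reasoning
    Qc-coloured : ∀ d → All (λ e → colour e ≡ d) (Qc ε (S d))
    Qc-coloured d = take⁺ _ (S-coloured d)
    vanish : ∀ d → d ≢ c → count (hasColour? c) (Qc ε (S d)) ≡ 0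
    vanish d d≢c = cong length (filter-none (hasColour? c)
      (All.map (λ col≡d col≡c → d≢c (trans (sym col≡d) col≡c)) (Qc-coloured d)))

lemma3 : (m : ℕ) (ε : ℚ) → 0ℚ < ε → ε < 1ℚ →
    (I : List (Item m)) → ValidInstance I →
    (S : Fin m → List (Item m)) →
    (∀ c → S c ↭ largeOfColour ε c I) →
    (∀ c → SortedDecreasing (S c)) →
    ((k : ℕ) → IsOPT I k →
      ℕ→ℚ (length (firstFit (Qseq ε S))) ≤ ε * ℕ→ℚ k)
    × ((c : Fin m) (k : ℕ) → IsOPT (colourClass c I) k →
      ℕ→ℚ (binsWithColour c (firstFit (Qseq ε S))) ≤ ε * ℕ→ℚ k)
lemma3 m ε 0<ε _ I valid S S↭large _ = bound-all , bound-colour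
  where
  instance
    ε-nonNeg : NonNegative ε
    ε-nonNeg = nonNegative (<⇒≤ 0<ε)
  open ≤-Reasoning
  Q = Qseq ε S
  n : Fin m → ℕ
  n c = length (S c)

  0≤I : All (λ e → 0ℚ ≤ size e) I
  0≤I = All.map (λ size-bounds → <⇒≤ (proj₁ size-bounds)) valid

  n-total : sum (map n (allFin m)) ≡ count (large? ε) I
  n-total = trans (cong sum (map-cong (λ c → ↭-length (S↭large c)) (allFin m))) (count-partition colour (large? ε) I)

  bound-all : (k : ℕ) → IsOPT I k → ℕ→ℚ (length (firstFit Q)) ≤ ε * ℕ→ℚ k
  bound-all k opt = begin
    ℕ→ℚ (length (firstFit Q))                                ≤⟨ ℕ→ℚ-mono (firstFit-length Q) ⟩
    ℕ→ℚ (length Q)                                           ≡⟨ cong ℕ→ℚ (Qseq-length ε S) ⟩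
    ℕ→ℚ (sum (map (λ c → length (Qc ε (S c))) (allFin m)))   ≤⟨ ℕ→ℚ-sum-≤ _ n _ (allFin m) (λ c → Qc-length-≤ ε (S c)) ⟩
    ℕ→ℚ (sum (map n (allFin m))) * (ε * ε * ε)               ≡⟨ cong (λ N → ℕ→ℚ N * (ε * ε * ε)) n-total ⟩
    ℕ→ℚ (count (large? ε) I) * (ε * ε * ε)                   ≤⟨ large-count-ε³-≤ ε I k 0≤I opt ⟩
    ε * ℕ→ℚ k                                                ∎

  bound-colour : (c : Fin m) (k : ℕ) → IsOPT (colourClass c I) k → ℕ→ℚ (binsWithColour c (firstFit Q)) ≤ ε * ℕ→ℚ k
  bound-colour c k opt = begin
    ℕ→ℚ (binsWithColour c (firstFit Q))                       ≤⟨ ℕ→ℚ-mono (binsWithColour-≤ c Q) ⟩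
    ℕ→ℚ (count (hasColour? c) Q)                              ≡⟨ cong ℕ→ℚ (Qseq-count ε S S-coloured c) ⟩
    ℕ→ℚ (length (Qc ε (S c)))                                 ≤⟨ Qc-length-≤ ε (S c) ⟩
    ℕ→ℚ (n c) * (ε * ε * ε)                                   ≡⟨ cong (λ N → ℕ→ℚ N * (ε * ε * ε)) (↭-length (S↭large c)) ⟩
    ℕ→ℚ (count (large? ε) (colourClass c I)) * (ε * ε * ε)   ≤⟨ large-count-ε³-≤ ε (colourClass c I) k (filter⁺ (hasColour? c) 0≤I) opt ⟩
    ε * ℕ→ℚ k                                                 ∎
    where
    S-coloured : ∀ d → All (λ e → colour e ≡ d) (S d)
    S-coloured d = arranged-coloured ε d I (S d) (S↭large d)
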